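{- Let $A \subseteq \mathbb{N}$ be an arbitrary set. Then $A$ contains a subset $B$ satisfying \[ \sup_{\substack{n, m \in B \\ n \neq m}} \gcd(m, n) < \infty \quad \text{and} \quad \sum_{n \in B} \frac{1}{n} = \infty \] if and only if there exist $n_0 \in \mathbb{N}$ and a set of primes $\mathcal{P} \subseteq \mathbb{P}$ such that $n_0 \mathcal{P} \subseteq A$ and $\sum_{p \in \mathcal{P}} \frac{1}{p} = \infty$.
   Context: $\mathbb{N}$ denotes the positive integers, $\mathbb{P}$ the set of primes, and $n_0\mathcal{P} = \{n_0 p : p \in \mathcal{P}\}$. -}

module Defs where

open import Level using (0ℓ)
open import Data.Nat using (ℕ; zero; suc; _≤_)
open import Data.Nat.GCD using (gcd)
open import Data.Integer using (+_)
open import Data.Rational using (ℚ; _/_; 0ℚ; _+_) renaming (_≤_ to _≤ℚ_)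
open import Data.List using (List; foldr)
open import Data.List.Relation.Unary.All using (All)
open import Data.List.Relation.Unary.Unique.Propositional using (Unique)
open import Data.Product using (∃-syntax; _×_)
open import Relation.Unary using (Pred)
open import Relation.Binary.PropositionalEquality using (_≢_)

-- reciprocal 1/n of a natural number (convention 1/0 := 0; only ever
-- applied to positive integers in the statement)
recip : ℕ → ℚ
recip zero    = 0ℚ
recip (suc n) = + 1 / suc n

sumRecip : List ℕ → ℚ
sumRecip = foldr (λ x acc → recip x + acc) 0ℚ

ℕtoℚ : ℕ → ℚ
ℕtoℚ K = + K / 1

-- ∑_{n ∈ S} 1/n = ∞ : finite partial sums over distinct elements of S
-- are unbounded
ReciprocalSumDiverges : Pred ℕ 0ℓ → Set
ReciprocalSumDiverges S =
  ∀ (K : ℕ) → ∃[ xs ] (Unique xs × All S xs × ℕtoℚ K ≤ℚ sumRecip xs)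

BoundedPairwiseGcd : Pred ℕ 0ℓ → Set
BoundedPairwiseGcd S =
  ∃[ K ] (∀ n m → S n → S m → n ≢ m → gcd m n ≤ K)

-- If n₀P ⊆ A for a set of primes P with Σ 1/p = ∞, take B = n₀P: distinct elements have
-- gcd exactly n₀, and Σ_{n∈B} 1/n = (1/n₀) Σ_{p∈P} 1/p.
-- Conversely, let distinct elements of B have gcd at most K₀ < K. An element n > K of B
-- either has a divisor w > K with w² ≤ n, or else n = d·p with d ≤ K² and p prime. Two
-- elements of the first kind cannot share such a w, so their reciprocals are dominated by
-- Σ 1/(w(w-1)) ≤ 1. Hence a divergent Σ_{n∈B} 1/n forces, for one of the finitely many
-- d ≤ K², divergence of Σ 1/p over the primes p with dp ∈ B; take n₀ = d.
module Submission where

open import Defs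
open import Level using (0ℓ)
open import Axiom.ExcludedMiddle using (ExcludedMiddle)
open import Axiom.DoubleNegationElimination using (em⇒dne)
open import Data.Nat
  using (ℕ; zero; suc; _+_; _*_; _∸_; _≤_; _<_; z≤n; s≤s; s≤s⁻¹; _⊔_; _≟_; _≤?_;
         NonZero; >-nonZero; ≢-nonZero; nonTrivial⇒n>1)
open import Data.Nat.Properties
open import Data.Nat.Divisibility using (_∣_; divides; ∣-refl; ∣⇒≤)
open import Data.Nat.GCD
  using (gcd; gcd-greatest; gcd[m,n]≢0; gcd[m,n]∣m; gcd[m,n]∣n; c*gcd[m,n]≡gcd[cm,cn])
open import Data.Nat.Primality using (Prime; prime⇒nonTrivial; prime⇒irreducible)
open import Data.Nat.Primality.Factorisation using (factorise)
open import Data.Nat.ListAction using (product)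
open import Data.Nat.Induction using (<-wellFounded)
open import Data.Nat.Tactic.RingSolver using (solve-∀)
open import Induction.WellFounded using (Acc; acc)
open import Data.Integer as ℤ using (+_)
import Data.Integer.Properties as ℤ
open import Data.Rational using (ℚ; _/_; 0ℚ; 1ℚ; toℚᵘ)
  renaming (_+_ to _+ℚ_; _*_ to _*ℚ_; _≤_ to _≤ℚ_)
import Data.Rational.Properties as ℚ
import Data.Rational.Unnormalised as ℚᵘ
import Data.Rational.Unnormalised.Properties as ℚᵘ
open import Algebra.Bundles using (CommutativeMonoid)
open import Algebra.Properties.CommutativeSemigroup
  (CommutativeMonoid.commutativeSemigroup ℚ.+-0-commutativeMonoid)
  using (x∙yz≈y∙xz; xy∙z≈y∙xz)
open import Data.List using (List; []; _∷_; foldr; map; filter; downFrom)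
open import Data.List.Relation.Unary.All as All using (All; []; _∷_)
import Data.List.Relation.Unary.All.Properties as All
open import Data.List.Relation.Unary.AllPairs using ([]; _∷_)
open import Data.List.Relation.Unary.Unique.Propositional using (Unique)
import Data.List.Relation.Unary.Unique.Propositional.Properties as Unique
open import Data.Product using (∃-syntax; _×_; _,_; proj₁; proj₂)
open import Data.Sum using (inj₁; inj₂)
open import Data.Empty using (⊥-elim)
open import Function using (_∘_)
open import Function.Bundles using (_⇔_; mk⇔)
open import Relation.Binary.PropositionalEquality
open import Relation.Nullary using (¬_; yes; no)
open import Relation.Unary using (Pred; Decidable; _⊆_; _∪_; U)
open import Relation.Unary.Properties using (∁?)

-- Arithmetic of fractions a / (1 + b)

toℚᵘ-fraction : ∀ a b → toℚᵘ (+ a / suc b) ℚᵘ.≃ ℚᵘ.mkℚᵘ (+ a) b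
toℚᵘ-fraction a b = ℚ.toℚᵘ-fromℚᵘ (ℚᵘ.mkℚᵘ (+ a) b)

fraction-+ : ∀ a b c d →
  + a / suc b +ℚ + c / suc d ≡ + (a * suc d + c * suc b) / (suc b * suc d)
fraction-+ a b c d = ℚ.toℚᵘ-injective (begin
  toℚᵘ (+ a / suc b +ℚ + c / suc d)
    ≈⟨ ℚ.toℚᵘ-homo-+ (+ a / suc b) (+ c / suc d) ⟩
  toℚᵘ (+ a / suc b) ℚᵘ.+ toℚᵘ (+ c / suc d)
    ≈⟨ ℚᵘ.+-cong (toℚᵘ-fraction a b) (toℚᵘ-fraction c d) ⟩
  ℚᵘ.mkℚᵘ (+ a) b ℚᵘ.+ ℚᵘ.mkℚᵘ (+ c) d
    ≡⟨ cong (λ i → ℚᵘ.mkℚᵘ i _) numerator ⟩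
  ℚᵘ.mkℚᵘ (+ (a * suc d + c * suc b)) _
    ≈⟨ ℚᵘ.≃-sym (toℚᵘ-fraction _ _) ⟩
  toℚᵘ (+ (a * suc d + c * suc b) / (suc b * suc d)) ∎)
  where
  open ℚᵘ.≃-Reasoning
  numerator : + a ℤ.* + suc d ℤ.+ + c ℤ.* + suc b ≡ + (a * suc d + c * suc b)
  numerator = sym (trans (ℤ.pos-+ (a * suc d) (c * suc b))
                         (cong₂ ℤ._+_ (ℤ.pos-* a (suc d)) (ℤ.pos-* c (suc b))))

fraction-* : ∀ a b c d → (+ a / suc b) *ℚ (+ c / suc d) ≡ + (a * c) / (suc b * suc d)
fraction-* a b c d = ℚ.toℚᵘ-injective (begin
  toℚᵘ ((+ a / suc b) *ℚ (+ c / suc d))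
    ≈⟨ ℚ.toℚᵘ-homo-* (+ a / suc b) (+ c / suc d) ⟩
  toℚᵘ (+ a / suc b) ℚᵘ.* toℚᵘ (+ c / suc d)
    ≈⟨ ℚᵘ.*-cong (toℚᵘ-fraction a b) (toℚᵘ-fraction c d) ⟩
  ℚᵘ.mkℚᵘ (+ a) b ℚᵘ.* ℚᵘ.mkℚᵘ (+ c) d
    ≡⟨ cong (λ i → ℚᵘ.mkℚᵘ i _) (sym (ℤ.pos-* a c)) ⟩
  ℚᵘ.mkℚᵘ (+ (a * c)) _
    ≈⟨ ℚᵘ.≃-sym (toℚᵘ-fraction _ _) ⟩
  toℚᵘ (+ (a * c) / (suc b * suc d)) ∎)
  where open ℚᵘ.≃-Reasoning

fraction-≤⁺ : ∀ a b c d → a * suc d ≤ c * suc b → + a / suc b ≤ℚ + c / suc d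
fraction-≤⁺ a b c d le = ℚ.toℚᵘ-cancel-≤
  (ℚᵘ.≤-respˡ-≃ (ℚᵘ.≃-sym (toℚᵘ-fraction a b))
    (ℚᵘ.≤-respʳ-≃ (ℚᵘ.≃-sym (toℚᵘ-fraction c d))
      (ℚᵘ.*≤* (subst₂ ℤ._≤_ (ℤ.pos-* a (suc d)) (ℤ.pos-* c (suc b)) (ℤ.+≤+ le)))))

fraction-≤⁻ : ∀ a b c d → + a / suc b ≤ℚ + c / suc d → a * suc d ≤ c * suc b
fraction-≤⁻ a b c d le
  with ℚᵘ.≤-respˡ-≃ (toℚᵘ-fraction a b) (ℚᵘ.≤-respʳ-≃ (toℚᵘ-fraction c d) (ℚ.toℚᵘ-mono-≤ le))
... | ℚᵘ.*≤* cross =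
  ℤ.drop‿+≤+ (subst₂ ℤ._≤_ (sym (ℤ.pos-* a (suc d))) (sym (ℤ.pos-* c (suc b))) cross)

fraction-≡ : ∀ a b c d → a * suc d ≡ c * suc b → + a / suc b ≡ + c / suc d
fraction-≡ a b c d eq = ℚ.≤-antisym (fraction-≤⁺ a b c d (≤-reflexive eq))
                                    (fraction-≤⁺ c d a b (≤-reflexive (sym eq)))

recip-nonNeg : ∀ n → 0ℚ ≤ℚ recip n
recip-nonNeg zero    = ℚ.≤-refl
recip-nonNeg (suc n) = fraction-≤⁺ 0 0 1 n z≤n

recip≤1 : ∀ n → recip n ≤ℚ 1ℚ
recip≤1 zero    = fraction-≤⁺ 0 0 1 0 z≤n
recip≤1 (suc n) = fraction-≤⁺ 1 n 1 0 (s≤s z≤n)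

recip-antimono : ∀ {m n} → 1 ≤ m → m ≤ n → recip n ≤ℚ recip m
recip-antimono {suc m} {suc n} _ m≤n = fraction-≤⁺ 1 n 1 m (*-monoʳ-≤ 1 m≤n)

recip[m*n]≤recip[n] : ∀ m n → recip (suc m * n) ≤ℚ recip n
recip[m*n]≤recip[n] m zero    rewrite *-zeroʳ m = ℚ.≤-refl
recip[m*n]≤recip[n] m (suc n) = recip-antimono (s≤s z≤n) (m≤n*m (suc n) (suc m))

recip-telescope : ∀ n → recip (suc (suc n) * suc n) +ℚ recip (suc (suc n)) ≡ recip (suc n)
recip-telescope n = trans (fraction-+ 1 m 1 (suc n))
  (fraction-≡ (1 * suc (suc n) + 1 * suc m) (suc n + m * suc (suc n)) 1 n (cross n))
  where
  m = n + suc n * suc n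
  cross : ∀ n → (1 * suc (suc n) + 1 * (suc (suc n) * suc n)) * suc n
              ≡ 1 * ((suc (suc n) * suc n) * suc (suc n))
  cross = solve-∀

ℕtoℚ-+ : ∀ a b → ℕtoℚ (a + b) ≡ ℕtoℚ a +ℚ ℕtoℚ b
ℕtoℚ-+ a b = sym (trans (fraction-+ a 0 b 0) (fraction-≡ (a * 1 + b * 1) 0 (a + b) 0 (cross a b)))
  where
  cross : ∀ a b → (a * 1 + b * 1) * 1 ≡ (a + b) * 1
  cross = solve-∀

ℕtoℚ-* : ∀ a b → ℕtoℚ (a * b) ≡ ℕtoℚ a *ℚ ℕtoℚ b
ℕtoℚ-* a b = sym (trans (fraction-* a 0 b 0) (fraction-≡ (a * b) 0 (a * b) 0 refl))

ℕtoℚ-suc≰ : ∀ n → ¬ ℕtoℚ (suc n) ≤ℚ ℕtoℚ n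
ℕtoℚ-suc≰ n le =
  1+n≰n (subst₂ _≤_ (*-identityʳ (suc n)) (*-identityʳ n) (fraction-≤⁻ (suc n) 0 n 0 le))

ℕtoℚ*recip : ∀ a b → ℕtoℚ (suc a) *ℚ recip (suc a * suc b) ≡ recip (suc b)
ℕtoℚ*recip a b = trans (fraction-* (suc a) 0 1 (b + a * suc b))
                       (fraction-≡ (suc a * 1) (b + a * suc b + 0) 1 b (cross a b))
  where
  cross : ∀ a b → (suc a * 1) * suc b ≡ 1 * suc (b + a * suc b + 0)
  cross = solve-∀

-- Sums over finite sets

sumOf : (ℕ → ℚ) → List ℕ → ℚ
sumOf g = foldr (λ x acc → g x +ℚ acc) 0ℚ

sumOf-filter : ∀ g {P : Pred ℕ 0ℓ} (P? : Decidable P) xs →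
  sumOf g xs ≡ sumOf g (filter P? xs) +ℚ sumOf g (filter (∁? P?) xs)
sumOf-filter g P? []       = sym (ℚ.+-identityˡ 0ℚ)
sumOf-filter g P? (x ∷ xs) with P? x
... | yes _ = trans (cong (g x +ℚ_) (sumOf-filter g P? xs)) (sym (ℚ.+-assoc (g x) _ _))
... | no  _ = trans (cong (g x +ℚ_) (sumOf-filter g P? xs))
                    (x∙yz≈y∙xz (g x) (sumOf g (filter P? xs)) (sumOf g (filter (∁? P?) xs)))

sumOf-unique-≡ : ∀ {g v xs} → (∀ n → 0ℚ ≤ℚ g n) →
  Unique xs → All (_≡ v) xs → sumOf g xs ≤ℚ g v
sumOf-unique-≡     g≥0 []                  []                = g≥0 _
sumOf-unique-≡ {g} g≥0 ([] ∷ [])           (refl ∷ [])       = ℚ.≤-reflexive (ℚ.+-identityʳ (g _))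
sumOf-unique-≡     g≥0 ((x≢y ∷ _) ∷ _)     (refl ∷ refl ∷ _) = ⊥-elim (x≢y refl)

sumOf-unique≤sumOf-downFrom : ∀ {g M xs} → (∀ n → 0ℚ ≤ℚ g n) →
  Unique xs → All (_< M) xs → sumOf g xs ≤ℚ sumOf g (downFrom M)
sumOf-unique≤sumOf-downFrom {M = zero}  g≥0 [] [] = ℚ.≤-refl
sumOf-unique≤sumOf-downFrom {g} {suc M} {xs} g≥0 xs! xs<1+M = begin
  sumOf g xs
    ≡⟨ sumOf-filter g (_≟ M) xs ⟩
  sumOf g (filter (_≟ M) xs) +ℚ sumOf g (filter (∁? (_≟ M)) xs)
    ≤⟨ ℚ.+-mono-≤ (sumOf-unique-≡ g≥0 (Unique.filter⁺ (_≟ M) xs!) (All.all-filter (_≟ M) xs))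
                  (sumOf-unique≤sumOf-downFrom g≥0 (Unique.filter⁺ (∁? (_≟ M)) xs!) rest<M) ⟩
  g M +ℚ sumOf g (downFrom M) ∎
  where
  open ℚ.≤-Reasoning
  rest<M : All (_< M) (filter (∁? (_≟ M)) xs)
  rest<M = All.zipWith (λ (x<1+M , x≢M) → ≤∧≢⇒< (s≤s⁻¹ x<1+M) x≢M)
             (All.filter⁺ (∁? (_≟ M)) xs<1+M , All.all-filter (∁? (_≟ M)) xs)

boundedAbove : ∀ xs → ∃[ M ] All (_< M) xs
boundedAbove []       = 0 , []
boundedAbove (x ∷ xs) with boundedAbove xs
... | M , xs<M = suc x ⊔ M ,
  m≤m⊔n (suc x) M ∷ All.map (λ y<M → ≤-trans y<M (m≤n⊔m (suc x) M)) xs<M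

record BoundedSum (g : ℕ → ℚ) (S : Pred ℕ 0ℓ) : Set where
  constructor boundedBy
  field
    bound       : ℕ
    sumOf≤bound : ∀ xs → Unique xs → All S xs → sumOf g xs ≤ℚ ℕtoℚ bound

module _ {g : ℕ → ℚ} where

  boundedSum-⊆ : ∀ {S T} → S ⊆ T → BoundedSum g T → BoundedSum g S
  boundedSum-⊆ S⊆T (boundedBy C bound) =
    boundedBy C λ xs xs! xs∈S → bound xs xs! (All.map S⊆T xs∈S)

  boundedSum-∪ : ∀ {S T} → Decidable S → BoundedSum g S → BoundedSum g T → BoundedSum g (S ∪ T)
  boundedSum-∪ {S} {T} S? (boundedBy C boundS) (boundedBy D boundT) =
    boundedBy (C + D) λ xs xs! xs∈S∪T → begin
      sumOf g xs
        ≡⟨ sumOf-filter g S? xs ⟩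
      sumOf g (filter S? xs) +ℚ sumOf g (filter (∁? S?) xs)
        ≤⟨ ℚ.+-mono-≤ (boundS _ (Unique.filter⁺ S? xs!) (All.all-filter S? xs))
                      (boundT _ (Unique.filter⁺ (∁? S?) xs!) (rest∈T xs∈S∪T)) ⟩
      ℕtoℚ C +ℚ ℕtoℚ D
        ≡⟨ ℕtoℚ-+ C D ⟨
      ℕtoℚ (C + D) ∎
    where
    open ℚ.≤-Reasoning
    rest∈T : ∀ {xs} → All (S ∪ T) xs → All T (filter (∁? S?) xs)
    rest∈T {xs} xs∈S∪T = All.zipWith (λ { (inj₁ s , ¬s) → ⊥-elim (¬s s) ; (inj₂ t , _) → t })
                           (All.filter⁺ (∁? S?) xs∈S∪T , All.all-filter (∁? S?) xs)

  boundedSum-⋃ : ∀ {M} {S : ℕ → Pred ℕ 0ℓ} → (∀ d → Decidable (S d)) →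
    (∀ d → d < M → BoundedSum g (S d)) → BoundedSum g (λ n → ∃[ d ] (d < M × S d n))
  boundedSum-⋃ {zero} _ _ =
    boundedBy 0 λ { [] _ [] → ℚ.≤-refl ; (_ ∷ _) _ ((_ , () , _) ∷ _) }
  boundedSum-⋃ {suc M} {S} S? bounded = boundedSum-⊆ split
    (boundedSum-∪ (S? M) (bounded M ≤-refl)
      (boundedSum-⋃ S? (λ d d<M → bounded d (m≤n⇒m≤1+n d<M))))
    where
    split : (λ n → ∃[ d ] (d < suc M × S d n)) ⊆ S M ∪ (λ n → ∃[ d ] (d < M × S d n))
    split (d , d<1+M , s) with d ≟ M
    ... | yes refl = inj₁ s
    ... | no  d≢M  = inj₂ (d , ≤∧≢⇒< (s≤s⁻¹ d<1+M) d≢M , s)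

  boundedSum-dominated : ∀ {h S T} (f : ∀ {n} → S n → ℕ) →
    (∀ {n} (s : S n) → T (f s)) → (∀ {n} (s : S n) → g n ≤ℚ h (f s)) →
    (∀ {n n′} (s : S n) (s′ : S n′) → f s ≡ f s′ → n ≡ n′) →
    BoundedSum h T → BoundedSum g S
  boundedSum-dominated {h} {S} {T} f f∈T g≤h∘f f-injective (boundedBy C bound) =
    boundedBy C λ xs xs! xs∈S →
      ℚ.≤-trans (sum-≤ xs∈S) (bound _ (images-unique xs! xs∈S) (images-∈ xs∈S))
    where
    sum-≤ : ∀ {xs} (ss : All S xs) → sumOf g xs ≤ℚ sumOf h (All.reduce f ss)
    sum-≤ []       = ℚ.≤-refl
    sum-≤ (s ∷ ss) = ℚ.+-mono-≤ (g≤h∘f s) (sum-≤ ss)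
    images-∈ : ∀ {xs} (ss : All S xs) → All T (All.reduce f ss)
    images-∈ []       = []
    images-∈ (s ∷ ss) = f∈T s ∷ images-∈ ss
    images-distinct : ∀ {x xs} (s : S x) → All (x ≢_) xs →
                      (ss : All S xs) → All (f s ≢_) (All.reduce f ss)
    images-distinct s []           []        = []
    images-distinct s (x≢y ∷ x≢ys) (s′ ∷ ss) = (x≢y ∘ f-injective s s′) ∷ images-distinct s x≢ys ss
    images-unique : ∀ {xs} → Unique xs → (ss : All S xs) → Unique (All.reduce f ss)
    images-unique []           []       = []
    images-unique (x∉xs ∷ xs!) (s ∷ ss) = images-distinct s x∉xs ss ∷ images-unique xs! ss

boundedSum⇒¬diverges : ∀ {S} → BoundedSum recip S → ¬ ReciprocalSumDiverges S
boundedSum⇒¬diverges (boundedBy C bound) diverges with diverges (suc C)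
... | xs , xs! , xs∈S , 1+C≤sum = ℕtoℚ-suc≰ C (ℚ.≤-trans 1+C≤sum (bound xs xs! xs∈S))

¬diverges⇒boundedSum : ExcludedMiddle 0ℓ → ∀ {S} → ¬ ReciprocalSumDiverges S → BoundedSum recip S
¬diverges⇒boundedSum em ¬diverges = dne λ ¬bounded → ¬diverges λ K → dne λ ¬reaches →
  ¬bounded (boundedBy K λ xs xs! xs∈S →
    ℚ.<⇒≤ (ℚ.≰⇒> (λ K≤sum → ¬reaches (xs , xs! , xs∈S , K≤sum))))
  where dne = em⇒dne em

sumOf-recip-downFrom : ∀ M → sumOf recip (downFrom M) ≤ℚ ℕtoℚ M
sumOf-recip-downFrom zero    = ℚ.≤-refl
sumOf-recip-downFrom (suc M) = begin
  recip M +ℚ sumOf recip (downFrom M)  ≤⟨ ℚ.+-mono-≤ (recip≤1 M) (sumOf-recip-downFrom M) ⟩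
  1ℚ +ℚ ℕtoℚ M                         ≡⟨ ℕtoℚ-+ 1 M ⟨
  ℕtoℚ (suc M)                         ∎
  where open ℚ.≤-Reasoning

boundedSum-recip-≤ : ∀ K → BoundedSum recip (_≤ K)
boundedSum-recip-≤ K = boundedBy (suc K) λ xs xs! xs≤K →
  ℚ.≤-trans (sumOf-unique≤sumOf-downFrom recip-nonNeg xs! (All.map s≤s xs≤K))
            (sumOf-recip-downFrom (suc K))

-- For w ≥ 2 this is 1/(w-1) - 1/w, and it vanishes at w = 0, 1 since recip 0 = 0.
pronicRecip : ℕ → ℚ
pronicRecip w = recip (w * (w ∸ 1))

sumOf-pronicRecip-downFrom : ∀ M →
  sumOf pronicRecip (downFrom (suc (suc M))) +ℚ recip (suc M) ≤ℚ 1ℚ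
sumOf-pronicRecip-downFrom zero    = ℚ.≤-refl
sumOf-pronicRecip-downFrom (suc M) = begin
  (pronicRecip (2 + M) +ℚ Σ) +ℚ recip (2 + M)
    ≡⟨ xy∙z≈y∙xz (pronicRecip (2 + M)) Σ (recip (2 + M)) ⟩
  Σ +ℚ (pronicRecip (2 + M) +ℚ recip (2 + M))
    ≡⟨ cong (Σ +ℚ_) (recip-telescope M) ⟩
  Σ +ℚ recip (suc M)
    ≤⟨ sumOf-pronicRecip-downFrom M ⟩
  1ℚ ∎
  where
  open ℚ.≤-Reasoning
  Σ = sumOf pronicRecip (downFrom (suc (suc M)))

sumOf-pronicRecip-unique≤1 : ∀ {xs} → Unique xs → sumOf pronicRecip xs ≤ℚ 1ℚ
sumOf-pronicRecip-unique≤1 {xs} xs! with boundedAbove xs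
... | M , xs<M = begin
  sumOf pronicRecip xs  ≤⟨ sumOf-unique≤sumOf-downFrom (recip-nonNeg ∘ λ w → w * (w ∸ 1)) xs! xs<2+M ⟩
  Σ                     ≡⟨ ℚ.+-identityʳ Σ ⟨
  Σ +ℚ 0ℚ               ≤⟨ ℚ.+-monoʳ-≤ Σ (recip-nonNeg (suc M)) ⟩
  Σ +ℚ recip (suc M)    ≤⟨ sumOf-pronicRecip-downFrom M ⟩
  1ℚ                    ∎
  where
  open ℚ.≤-Reasoning
  Σ = sumOf pronicRecip (downFrom (2 + M))
  xs<2+M : All (_< 2 + M) xs
  xs<2+M = All.map (λ x<M → ≤-trans x<M (m≤n+m M 2)) xs<M

recip≤pronicRecip : ∀ {n w} → 2 ≤ w → w * w ≤ n → recip n ≤ℚ pronicRecip w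
recip≤pronicRecip {w = 1}           (s≤s ()) _
recip≤pronicRecip {w = suc (suc k)} _        w*w≤n =
  recip-antimono (s≤s z≤n) (≤-trans (*-monoʳ-≤ (suc (suc k)) (n≤1+n (suc k))) w*w≤n)

dilate : ℕ → Pred ℕ 0ℓ → Pred ℕ 0ℓ
dilate d P n = ∃[ p ] (P p × n ≡ d * p)

boundedSum-dilate : ∀ d {P} → BoundedSum recip P → BoundedSum recip (dilate (suc d) P)
boundedSum-dilate d = boundedSum-dominated proj₁ (proj₁ ∘ proj₂)
  (λ { (p , _ , refl) → recip[m*n]≤recip[n] d p })
  (λ { (p , _ , refl) (.p , _ , refl) refl → refl })

ℕtoℚ*sumOf-recip-map : ∀ a {ys} → All (1 ≤_) ys →
  ℕtoℚ (suc a) *ℚ sumOf recip (map (suc a *_) ys) ≡ sumOf recip ys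
ℕtoℚ*sumOf-recip-map a []                      = ℚ.*-zeroʳ (ℕtoℚ (suc a))
ℕtoℚ*sumOf-recip-map a {suc b ∷ ys} (_ ∷ ys≥1) =
  trans (ℚ.*-distribˡ-+ (ℕtoℚ (suc a)) (recip (suc a * suc b)) (sumOf recip (map (suc a *_) ys)))
        (cong₂ _+ℚ_ (ℕtoℚ*recip a b) (ℕtoℚ*sumOf-recip-map a ys≥1))

diverges-dilate : ∀ a {P} → (∀ {p} → P p → 1 ≤ p) →
  ReciprocalSumDiverges P → ReciprocalSumDiverges (dilate (suc a) P)
diverges-dilate a {P} P-pos diverges K with diverges (K * suc a)
... | ys , ys! , ys∈P , K*n₀≤sum =
  map (suc a *_) ys ,
  Unique.map⁺ (*-cancelˡ-≡ _ _ (suc a)) ys! ,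
  All.map⁺ (All.map (λ p∈P → _ , p∈P , refl) ys∈P) ,
  ℚ.*-cancelˡ-≤-pos (ℕtoℚ (suc a)) {{ℚ.normalize-pos (suc a) 1}} (begin
    ℕtoℚ (suc a) *ℚ ℕtoℚ K                           ≡⟨ ℕtoℚ-* (suc a) K ⟨
    ℕtoℚ (suc a * K)                                 ≡⟨ cong ℕtoℚ (*-comm (suc a) K) ⟩
    ℕtoℚ (K * suc a)                                 ≤⟨ K*n₀≤sum ⟩
    sumOf recip ys                                   ≡⟨ ℕtoℚ*sumOf-recip-map a (All.map P-pos ys∈P) ⟨
    ℕtoℚ (suc a) *ℚ sumOf recip (map (suc a *_) ys)  ∎)
  where open ℚ.≤-Reasoning

-- Primes and divisors

prime⇒≥2 : ∀ {p} → Prime p → 2 ≤ p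
prime⇒≥2 {p} p-prime = nonTrivial⇒n>1 p {{prime⇒nonTrivial p-prime}}

∃-prime-divisor : ∀ {w} → 2 ≤ w → ∃[ q ] (Prime q × q ∣ w)
∃-prime-divisor {w@(suc _)} 2≤w with factorise w
... | record { factors = [] ; isFactorisation = w≡1 } = ⊥-elim (<-irrefl (sym w≡1) 2≤w)
... | record { factors = q ∷ qs ; isFactorisation = w≡q*qs ; factorsPrime = q-prime ∷ _ } =
  q , q-prime , divides (product qs) (trans w≡q*qs (*-comm q (product qs)))

gcd-distinct-primes : ∀ {p q} → Prime p → Prime q → p ≢ q → gcd p q ≡ 1
gcd-distinct-primes {p} {q} p-prime q-prime p≢q with prime⇒irreducible p-prime (gcd[m,n]∣m p q)
... | inj₁ gcd≡1 = gcd≡1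
... | inj₂ gcd≡p with prime⇒irreducible q-prime (subst (_∣ q) gcd≡p (gcd[m,n]∣n p q))
...   | inj₁ p≡1 = ⊥-elim (<⇒≢ (prime⇒≥2 p-prime) (sym p≡1))
...   | inj₂ p≡q = ⊥-elim (p≢q p≡q)

boundedPairwiseGcd-dilate : ∀ n₀ {P} → P ⊆ Prime → BoundedPairwiseGcd (dilate n₀ P)
boundedPairwiseGcd-dilate n₀ P⊆Prime = n₀ , λ
  { _ _ (p , p∈P , refl) (q , q∈P , refl) n₀p≢n₀q → ≤-reflexive (begin
      gcd (n₀ * q) (n₀ * p)  ≡⟨ c*gcd[m,n]≡gcd[cm,cn] n₀ q p ⟨
      n₀ * gcd q p           ≡⟨ cong (n₀ *_) (gcd-distinct-primes (P⊆Prime q∈P) (P⊆Prime p∈P)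
                                                                 (n₀p≢n₀q ∘ cong (n₀ *_) ∘ sym)) ⟩
      n₀ * 1                 ≡⟨ *-identityʳ n₀ ⟩
      n₀                     ∎) }
  where open ≡-Reasoning

1≤m*n⇒1≤m : ∀ m {n} → 1 ≤ m * n → 1 ≤ m
1≤m*n⇒1≤m (suc m) _ = s≤s z≤n

module _ {K n : ℕ} (1≤K : 1 ≤ K) (1≤n : 1 ≤ n)
         (noLargeSquareDivisor : ∀ {w} → K < w → w ∣ n → n < w * w) where

  cofactor≤K : ∀ {c w} → K < w → n ≡ c * w → c ≤ K
  cofactor≤K {c} {w} K<w n≡c*w with c ≤? K
  ... | yes c≤K = c≤K
  ... | no  c≰K = ⊥-elim (<-irrefl n*n≡c*c*[w*w] (*-mono-< n<c*c n<w*w))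
    where
    n<c*c : n < c * c
    n<c*c = noLargeSquareDivisor (≰⇒> c≰K) (divides w (trans n≡c*w (*-comm c w)))
    n<w*w : n < w * w
    n<w*w = noLargeSquareDivisor K<w (divides c n≡c*w)
    rearrange : ∀ c w → (c * w) * (c * w) ≡ (c * c) * (w * w)
    rearrange = solve-∀
    n*n≡c*c*[w*w] : n * n ≡ (c * c) * (w * w)
    n*n≡c*c*[w*w] = trans (cong₂ _*_ n≡c*w n≡c*w) (rearrange c w)

  -- Descend through divisors above K, stripping one prime factor at a time.
  smallMultipleOfPrime′ : ∀ {w} → Acc _<_ w → K < w → w ∣ n →
    ∃[ d ] ∃[ p ] (1 ≤ d × d ≤ K * K × Prime p × n ≡ d * p)
  smallMultipleOfPrime′ {w} (acc smaller) K<w (divides c n≡c*w)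
    with ∃-prime-divisor (≤-trans (s≤s 1≤K) K<w)
  ... | q , q-prime , divides w′ w≡w′*q with w′ ≤? K
  ...   | yes w′≤K = c * w′ , q , 1≤m*n⇒1≤m (c * w′) (subst (1 ≤_) n≡cw′*q 1≤n) ,
                     *-mono-≤ (cofactor≤K {c} K<w n≡c*w) w′≤K , q-prime , n≡cw′*q
    where
    n≡cw′*q : n ≡ (c * w′) * q
    n≡cw′*q = trans n≡c*w (trans (cong (c *_) w≡w′*q) (sym (*-assoc c w′ q)))
  ...   | no  w′≰K = smallMultipleOfPrime′ (smaller w′<w) (≰⇒> w′≰K) (divides (c * q) n≡cq*w′)
    where
    w′<w : w′ < w
    w′<w = subst (w′ <_) (sym w≡w′*q)
             (m<m*n w′ q {{>-nonZero (≤-trans (s≤s z≤n) (≰⇒> w′≰K))}} (prime⇒≥2 q-prime))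
    n≡cq*w′ : n ≡ (c * q) * w′
    n≡cq*w′ = trans n≡c*w (trans (cong (c *_) (trans w≡w′*q (*-comm w′ q))) (sym (*-assoc c q w′)))

  smallMultipleOfPrime : K < n → ∃[ d ] ∃[ p ] (1 ≤ d × d ≤ K * K × Prime p × n ≡ d * p)
  smallMultipleOfPrime K<n = smallMultipleOfPrime′ (<-wellFounded n) K<n ∣-refl

-- Sets with bounded pairwise gcd

module BoundedGcd (em : ExcludedMiddle 0ℓ) {B : Pred ℕ 0ℓ} (B-pos : ∀ {n} → B n → 1 ≤ n)
                  (K₀ : ℕ) (gcd≤K₀ : ∀ n m → B n → B m → n ≢ m → gcd m n ≤ K₀) where

  K : ℕ
  K = suc K₀

  primeCofactors : ℕ → Pred ℕ 0ℓ
  primeCofactors d p = Prime p × B (d * p)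

  LargeSquareDivisor : ℕ → ℕ → Set
  LargeSquareDivisor n w = K < w × w ∣ n × w * w ≤ n

  commonDivisor>K₀⇒≡ : ∀ {n n′ w} → B n → B n′ → w ∣ n → w ∣ n′ → K₀ < w → n ≡ n′
  commonDivisor>K₀⇒≡ {n} {n′} {w} n∈B n′∈B w∣n w∣n′ K₀<w with n ≟ n′
  ... | yes n≡n′ = n≡n′
  ... | no  n≢n′ = ⊥-elim (<⇒≱ K₀<w (≤-trans (∣⇒≤ {{gcd≢0}} (gcd-greatest w∣n′ w∣n))
                                             (gcd≤K₀ n n′ n∈B n′∈B n≢n′)))
    where
    gcd≢0 : NonZero (gcd n′ n)
    gcd≢0 = ≢-nonZero (gcd[m,n]≢0 n′ n (inj₁ (λ n′≡0 → <⇒≢ (B-pos n′∈B) (sym n′≡0))))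

  boundedSum-largeSquareDivisor : BoundedSum recip (λ n → B n × ∃[ w ] LargeSquareDivisor n w)
  boundedSum-largeSquareDivisor = boundedSum-dominated {T = U} (proj₁ ∘ proj₂) _
    (λ (_ , _ , K<w , _ , w*w≤n) → recip≤pronicRecip (≤-trans (s≤s (s≤s z≤n)) K<w) w*w≤n)
    (λ { (n∈B , w , K<w , w∣n , _) (n′∈B , .w , _ , w∣n′ , _) refl →
           commonDivisor>K₀⇒≡ n∈B n′∈B w∣n w∣n′ (<-trans (n<1+n K₀) K<w) })
    (boundedBy 1 λ _ xs! _ → sumOf-pronicRecip-unique≤1 xs!)

  cover : B ⊆ (_≤ K) ∪ ((λ n → B n × ∃[ w ] LargeSquareDivisor n w)
                       ∪ (λ n → ∃[ d ] (d < K * K × dilate (suc d) (primeCofactors (suc d)) n)))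
  cover {n} n∈B with n ≤? K
  ... | yes n≤K = inj₁ n≤K
  ... | no  n≰K with em {∃[ w ] LargeSquareDivisor n w}
  ...   | yes large = inj₂ (inj₁ (n∈B , large))
  ...   | no  ¬large with smallMultipleOfPrime (s≤s z≤n) (B-pos n∈B) small (≰⇒> n≰K)
    where
    small : ∀ {w} → K < w → w ∣ n → n < w * w
    small K<w w∣n = ≰⇒> (λ w*w≤n → ¬large (_ , K<w , w∣n , w*w≤n))
  ...     | suc d , p , _ , 1+d≤K*K , p-prime , n≡ =
    inj₂ (inj₂ (d , 1+d≤K*K , p , (p-prime , subst B n≡ n∈B) , n≡))

  boundedSum-B : (∀ d → d < K * K → ¬ ReciprocalSumDiverges (primeCofactors (suc d))) →
    BoundedSum recip B
  boundedSum-B converges = boundedSum-⊆ cover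
    (boundedSum-∪ (_≤? K) (boundedSum-recip-≤ K)
      (boundedSum-∪ (λ _ → em) boundedSum-largeSquareDivisor
        (boundedSum-⋃ (λ _ _ → em) λ d d<K*K →
          boundedSum-dilate d (¬diverges⇒boundedSum em (converges d d<K*K)))))

  ∃-diverging-primeCofactors : ReciprocalSumDiverges B →
    ∃[ d ] ReciprocalSumDiverges (primeCofactors (suc d))
  ∃-diverging-primeCofactors B-diverges
    with em {∃[ d ] (d < K * K × ReciprocalSumDiverges (primeCofactors (suc d)))}
  ... | yes (d , _ , diverges) = d , diverges
  ... | no  none = ⊥-elim (boundedSum⇒¬diverges
          (boundedSum-B (λ d d<K*K diverges → none (d , d<K*K , diverges))) B-diverges)

theoremA1 : ExcludedMiddle 0ℓ →
    (A : Pred ℕ 0ℓ) → (∀ n → A n → 1 ≤ n) →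
    (∃[ B ] ((B ⊆ A) × BoundedPairwiseGcd B × ReciprocalSumDiverges B))
    ⇔
    (∃[ n₀ ] ∃[ P ] (1 ≤ n₀ × (P ⊆ Prime) × (∀ p → P p → A (n₀ * p))
                     × ReciprocalSumDiverges P))
theoremA1 em A A-pos = mk⇔
  (λ (B , B⊆A , (K₀ , gcd≤K₀) , B-diverges) →
     let open BoundedGcd em (A-pos _ ∘ B⊆A) K₀ gcd≤K₀
         (d , diverges) = ∃-diverging-primeCofactors B-diverges
     in suc d , primeCofactors (suc d) , s≤s z≤n , proj₁ , (λ _ → B⊆A ∘ proj₂) , diverges)
  (λ { (zero , _ , () , _)
     ; (suc a , P , _ , P⊆Prime , n₀P⊆A , P-diverges) →
         dilate (suc a) P ,
         (λ { (p , p∈P , refl) → n₀P⊆A p p∈P }) ,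
         boundedPairwiseGcd-dilate (suc a) P⊆Prime ,
         diverges-dilate a (λ p∈P → ≤-trans (s≤s z≤n) (prime⇒≥2 (P⊆Prime p∈P))) P-diverges })
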